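{- Let $G$ be a bridgeless $3$-edge colourable cubic graph which is not bi-hamiltonian. Then $G$ has a proper Fulkerson covering.
   Context: A Fulkerson covering of $G$ is a family of $6$ perfect matchings of $G$ (not necessarily distinct) such that every edge of $G$ lies in exactly two of them; it is proper if the $6$ perfect matchings are pairwise distinct. A $3$-edge colourable cubic graph is bi-hamiltonian if in every proper $3$-edge colouring there are at least two colours such that removing the edges of that colour leaves a Hamiltonian cycle (a $2$-factor consisting of a single cycle). -}

module Defs where

open import Data.Nat using (ℕ)
open import Data.Fin using (Fin; _≟_)
open import Data.Fin.Subset using (Subset; _∈_)
open import Data.Fin.Subset.Properties using (_∈?_)
open import Data.List using (List; length; filter)
open import Data.List.Base using (allFin)
open import Data.Product using (_×_; _,_; proj₁; proj₂; Σ; ∃; ∃-syntax)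
open import Data.Sum using (_⊎_)
open import Relation.Nullary using (¬_; Dec)
open import Relation.Nullary.Decidable using (_⊎-dec_; _×-dec_)
open import Relation.Binary.PropositionalEquality using (_≡_; _≢_)

record Graph : Set where
  field
    n    : ℕ
    m    : ℕ
    ends : Fin m → Fin n × Fin n
    loopless : ∀ e → proj₁ (ends e) ≢ proj₂ (ends e)

module _ (G : Graph) where
  open Graph G

  Vertex = Fin n
  Edge   = Fin m

  Incident : Edge → Vertex → Set
  Incident e v = (v ≡ proj₁ (ends e)) ⊎ (v ≡ proj₂ (ends e))

  incident? : ∀ e v → Dec (Incident e v)
  incident? e v = (v ≟ proj₁ (ends e)) ⊎-dec (v ≟ proj₂ (ends e))

  Joins : Edge → Vertex → Vertex → Set
  Joins e u v = (ends e ≡ (u , v)) ⊎ (ends e ≡ (v , u))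

  degree : Vertex → ℕ
  degree v = length (filter (λ e → incident? e v) (allFin m))

  Cubic : Set
  Cubic = ∀ v → degree v ≡ 3

  data Reach (S : Edge → Set) : Vertex → Vertex → Set where
    here : ∀ {v} → Reach S v v
    step : ∀ {u x w} (e : Edge) → S e → Joins e u x → Reach S x w → Reach S u w

  Bridge : Edge → Set
  Bridge e = ¬ Reach (λ f → f ≢ e) (proj₁ (ends e)) (proj₂ (ends e))

  Bridgeless : Set
  Bridgeless = ∀ e → ¬ Bridge e

  PerfectMatching : Subset m → Set
  PerfectMatching M =
    ∀ v → ∃[ e ] (e ∈ M × Incident e v × (∀ f → f ∈ M → Incident f v → f ≡ e))

  Proper3EdgeColouring : (Edge → Fin 3) → Set
  Proper3EdgeColouring c =
    ∀ e f v → e ≢ f → Incident e v → Incident f v → c e ≢ c f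

  ThreeEdgeColourable : Set
  ThreeEdgeColourable = ∃[ c ] Proper3EdgeColouring c

  -- the spanning subgraph with edge set S is a Hamiltonian cycle:
  -- a 2-factor (every vertex has degree 2 in S) consisting of a single cycle
  -- (connected spanning subgraph)
  HamiltonianCycle : (S : Edge → Set) → (∀ e → Dec (S e)) → Set
  HamiltonianCycle S S? =
    (∀ v → length (filter (λ e → S? e ×-dec incident? e v) (allFin m)) ≡ 2)
    × (∀ u v → Reach S u v)

  RemovalHamiltonian : (Edge → Fin 3) → Fin 3 → Set
  RemovalHamiltonian c i =
    HamiltonianCycle (λ e → c e ≢ i) (λ e → Relation.Nullary.¬? (c e ≟ i))

  BiHamiltonian : Set
  BiHamiltonian =
    ∀ c → Proper3EdgeColouring c →
      ∃[ i ] ∃[ j ] (i ≢ j × RemovalHamiltonian c i × RemovalHamiltonian c j)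

  FulkersonCovering : (Fin 6 → Subset m) → Set
  FulkersonCovering M =
    (∀ i → PerfectMatching (M i))
    × (∀ e → length (filter (λ i → e ∈? M i) (allFin 6)) ≡ 2)

  ProperFulkersonCovering : Set
  ProperFulkersonCovering =
    ∃[ M ] (FulkersonCovering M × (∀ i j → i ≢ j → M i ≢ M j))

-- Since G is not bi-hamiltonian, some proper 3-edge colouring has two colours a and b whose removal
-- leaves a disconnected 2-factor; let t be the third colour.  Swapping b and t on one component of
-- the (b,t)-2-factor and a and t on one component of the (a,t)-2-factor gives proper colourings c₁
-- and c₂.  Their six colour classes are perfect matchings covering every edge exactly twice, and
-- edges at the centres of the two switches and at vertices outside the switched components
-- separate every class of c₁ from every class of c₂.  A proper Fulkerson covering is a finite
-- object, so its existence is decidable, which justifies extracting such a colouring from the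
-- negated hypothesis.

module Submission where

open import Defs
open import Data.Nat as ℕ using (ℕ; zero; suc; _≤_; s≤s)
import Data.Nat.Properties as ℕₚ
open import Data.Bool as Bool using (true; false)
open import Data.Fin using (Fin; zero; suc; _≟_; remQuot; quotient; remainder; combine)
open import Data.Fin.Properties using (any?; all?; ¬∀⟶∃¬; combine-remQuot)
import Data.Fin.Permutation.Components as PC
open import Data.Fin.Subset using (Subset; _∈_; _⊆_; _⊂_; ⁅_⁆; ∣_∣)
open import Data.Fin.Subset.Properties
  using (_∈?_; _⊆?_; x∈⁅x⁆; x∈⁅y⁆⇒x≡y; ∣⁅x⁆∣≡1; p⊂q⇒∣p∣<∣q∣; ∣p∣≤n; anySubset?)
open import Data.Vec using (tabulate)
open import Data.Vec.Properties as Vec using (lookup∘tabulate; []=⇒lookup; lookup⇒[]=)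
open import Data.Vec.Functional as Vector using (Vector; head; tail)
open import Data.Product using (_×_; _,_; proj₁; proj₂; ∃; ∃-syntax; uncurry)
import Data.Product.Properties as Product
open import Data.Sum using (_⊎_; inj₁; inj₂)
open import Data.Empty using (⊥-elim)
open import Data.List using (List; []; _∷_; length; filter; map)
open import Data.List.Base using (allFin)
open import Data.List.Properties using (filter-≐; filter-accept; filter-reject)
open import Data.List.Relation.Unary.All using (All; []; _∷_)
open import Data.List.Relation.Unary.All.Properties using (all-filter)
open import Data.List.Relation.Unary.AllPairs using ([]; _∷_)
open import Data.List.Relation.Unary.Unique.Propositional using (Unique)
import Data.List.Relation.Unary.Unique.Propositional.Properties as Unique
open import Function using (_∘_)
open import Relation.Binary.PropositionalEquality
open import Relation.Nullary using (¬_; Dec; yes; no; ¬?; does)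
open import Relation.Nullary.Decidable
  using (map′; from-yes; dec-true; dec-false; decidable-stable; _×-dec_; _⊎-dec_; _→-dec_)
open import Relation.Unary using (Decidable)

distinct-cover : ∀ (x y z : Fin 3) → x ≢ y → x ≢ z → y ≢ z →
  ∀ i → i ≡ x ⊎ i ≡ y ⊎ i ≡ z
distinct-cover = from-yes (all? {n = 3} λ x → all? λ y → all? λ z →
  ¬? (x ≟ y) →-dec ¬? (x ≟ z) →-dec ¬? (y ≟ z) →-dec
  all? λ i → (i ≟ x) ⊎-dec (i ≟ y) ⊎-dec (i ≟ z))

distinct-avoid-count : ∀ (x y z : Fin 3) → x ≢ y → x ≢ z → y ≢ z →
  ∀ i → length (filter (λ k → ¬? (k ≟ i)) (x ∷ y ∷ z ∷ [])) ≡ 2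
distinct-avoid-count = from-yes (all? {n = 3} λ x → all? λ y → all? λ z →
  ¬? (x ≟ y) →-dec ¬? (x ≟ z) →-dec ¬? (y ≟ z) →-dec
  all? λ i → length (filter (λ k → ¬? (k ≟ i)) (x ∷ y ∷ z ∷ [])) ℕ.≟ 2)

third-colour : ∀ (x y : Fin 3) → ∃[ z ] (x ≢ z × y ≢ z)
third-colour = from-yes (all? {n = 3} λ x → all? λ y → any? λ z → ¬? (x ≟ z) ×-dec ¬? (y ≟ z))

two-failures : ∀ {P : Fin 3 → Set} → Decidable P →
  ¬ (∃[ i ] ∃[ j ] (i ≢ j × P i × P j)) → ∃[ i ] ∃[ j ] (i ≢ j × ¬ P i × ¬ P j)
two-failures P? ¬two with P? zero | P? (suc zero) | P? (suc (suc zero))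
... | yes p₀ | yes p₁ | _      = ⊥-elim (¬two (_ , _ , (λ ()) , p₀ , p₁))
... | yes p₀ | no _   | yes p₂ = ⊥-elim (¬two (_ , _ , (λ ()) , p₀ , p₂))
... | no _   | yes p₁ | yes p₂ = ⊥-elim (¬two (_ , _ , (λ ()) , p₁ , p₂))
... | yes _  | no ¬p₁ | no ¬p₂ = _ , _ , (λ ()) , ¬p₁ , ¬p₂
... | no ¬p₀ | yes _  | no ¬p₂ = _ , _ , (λ ()) , ¬p₀ , ¬p₂
... | no ¬p₀ | no ¬p₁ | _      = _ , _ , (λ ()) , ¬p₀ , ¬p₁

transpose-injective : ∀ {n} (i j : Fin n) {x y} → PC.transpose i j x ≡ PC.transpose i j y → x ≡ y
transpose-injective i j {x} {y} eq = begin
  x                                         ≡⟨ PC.transpose-inverse j i ⟨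
  PC.transpose j i (PC.transpose i j x)     ≡⟨ cong (PC.transpose j i) eq ⟩
  PC.transpose j i (PC.transpose i j y)     ≡⟨ PC.transpose-inverse j i ⟩
  y                                         ∎
  where open ≡-Reasoning

transpose-matchˡ : ∀ {n} (i j : Fin n) → PC.transpose i j i ≡ j
transpose-matchˡ i j rewrite dec-true (i ≟ i) refl = refl

transpose-fixes : ∀ {n} {i j k : Fin n} → k ≢ i → k ≢ j → PC.transpose i j k ≡ k
transpose-fixes {i = i} {j} {k} k≢i k≢j rewrite dec-false (k ≟ i) k≢i | dec-false (k ≟ j) k≢j = refl

filter-×-dec : ∀ {A : Set} {P Q : A → Set} (P? : Decidable P) (Q? : Decidable Q) xs →
  filter (λ x → P? x ×-dec Q? x) xs ≡ filter P? (filter Q? xs)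
filter-×-dec P? Q? [] = refl
filter-×-dec {P = P} {Q} P? Q? (x ∷ xs) = by-cases (P? x) (Q? x)
  where
  open ≡-Reasoning
  PQ? : Decidable (λ y → P y × Q y)
  PQ? y = P? y ×-dec Q? y
  ih : filter PQ? xs ≡ filter P? (filter Q? xs)
  ih = filter-×-dec P? Q? xs
  by-cases : Dec (P x) → Dec (Q x) → filter PQ? (x ∷ xs) ≡ filter P? (filter Q? (x ∷ xs))
  by-cases (yes p) (yes q) = begin
    filter PQ? (x ∷ xs)                ≡⟨ filter-accept PQ? (p , q) ⟩
    x ∷ filter PQ? xs                  ≡⟨ cong (x ∷_) ih ⟩
    x ∷ filter P? (filter Q? xs)       ≡⟨ filter-accept P? p ⟨
    filter P? (x ∷ filter Q? xs)       ≡⟨ cong (filter P?) (filter-accept Q? q) ⟨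
    filter P? (filter Q? (x ∷ xs))     ∎
  by-cases (no ¬p) (yes q) = begin
    filter PQ? (x ∷ xs)                ≡⟨ filter-reject PQ? (¬p ∘ proj₁) ⟩
    filter PQ? xs                      ≡⟨ ih ⟩
    filter P? (filter Q? xs)           ≡⟨ filter-reject P? ¬p ⟨
    filter P? (x ∷ filter Q? xs)       ≡⟨ cong (filter P?) (filter-accept Q? q) ⟨
    filter P? (filter Q? (x ∷ xs))     ∎
  by-cases _ (no ¬q) = trans (filter-reject PQ? (¬q ∘ proj₂))
    (trans ih (cong (filter P?) (sym (filter-reject Q? ¬q))))

length-filter-map : ∀ {A B : Set} {P : B → Set} (P? : Decidable P) (f : A → B) xs →
  length (filter (P? ∘ f) xs) ≡ length (filter P? (map f xs))
length-filter-map P? f [] = refl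
length-filter-map P? f (x ∷ xs) with does (P? (f x))
... | true  = cong suc (length-filter-map P? f xs)
... | false = length-filter-map P? f xs

choose : ∀ {A : Set} → A → A → Fin 2 → A
choose x y zero    = x
choose x y (suc _) = y

-- Read through remQuot, Fin 6 is Fin 2 × Fin 3, and each of the two colours y₁, y₂ matches exactly one pair.
choose-count : ∀ (y₁ y₂ : Fin 3) →
  length (filter (λ i → choose y₁ y₂ (quotient {2} 3 i) ≟ remainder {2} 3 i) (allFin 6)) ≡ 2
choose-count = from-yes (all? {n = 3} λ y₁ → all? λ y₂ →
  length (filter (λ i → choose y₁ y₂ (quotient {2} 3 i) ≟ remainder {2} 3 i) (allFin 6)) ℕ.≟ 2)

remQuot-injective : ∀ {m} k {i j : Fin (m ℕ.* k)} → remQuot {m} k i ≡ remQuot k j → i ≡ j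
remQuot-injective {m} k {i} {j} eq = begin
  i                                  ≡⟨ combine-remQuot {m} k i ⟨
  uncurry combine (remQuot {m} k i)  ≡⟨ cong (uncurry combine) eq ⟩
  uncurry combine (remQuot {m} k j)  ≡⟨ combine-remQuot {m} k j ⟩
  j                                  ∎
  where open ≡-Reasoning

unique-triple : ∀ {A : Set} {P : A → Set} (xs : List A) → length xs ≡ 3 → All P xs → Unique xs →
  ∃[ a ] ∃[ b ] ∃[ c ] (xs ≡ a ∷ b ∷ c ∷ [] × P a × P b × P c × a ≢ b × a ≢ c × b ≢ c)
unique-triple (a ∷ b ∷ c ∷ []) refl (pa ∷ pb ∷ pc ∷ []) ((a≢b ∷ a≢c ∷ []) ∷ (b≢c ∷ []) ∷ _) =
  a , b , c , refl , pa , pb , pc , a≢b , a≢c , b≢c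

toSubset : ∀ {n} {P : Fin n → Set} → Decidable P → Subset n
toSubset P? = tabulate (does ∘ P?)

∈-toSubset⁺ : ∀ {n} {P : Fin n → Set} (P? : Decidable P) {x} → P x → x ∈ toSubset P?
∈-toSubset⁺ P? {x} px = lookup⇒[]= x _ (trans (lookup∘tabulate (does ∘ P?) x) (dec-true (P? x) px))

∈-toSubset⁻ : ∀ {n} {P : Fin n → Set} (P? : Decidable P) {x} → x ∈ toSubset P? → P x
∈-toSubset⁻ P? {x} x∈ = witness (P? x) (trans (sym (lookup∘tabulate (does ∘ P?) x)) ([]=⇒lookup x∈))
  where
  witness : ∀ {A : Set} (a? : Dec A) → does a? ≡ true → A
  witness (yes a) _ = a
  witness (no _) ()

-- Without function extensionality the search needs P to respect pointwise equality.
any-Vector? : ∀ k {B : Set} → (∀ {Q : B → Set} → Decidable Q → Dec (∃ Q)) →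
  {P : Vector B k → Set} → Decidable P → (∀ {f g} → f ≗ g → P f → P g) → Dec (∃ P)
any-Vector? zero ∃? {P} P? resp = map′ (λ p → (λ ()) , p) from-any (P? λ ())
  where
  from-any : ∃ P → P λ ()
  from-any (f , p) = resp (λ ()) p
any-Vector? (suc k) ∃? P? resp =
  map′ (λ (b , f , p) → b Vector.∷ f , p) (λ (f , p) → head f , tail f , resp (η f) p)
       (∃? λ b → any-Vector? k ∃? (P? ∘ (b Vector.∷_)) (resp ∘ ∷-cong b))
  where
  η : ∀ {B : Set} (f : Vector B (suc k)) → f ≗ head f Vector.∷ tail f
  η f zero    = refl
  η f (suc i) = refl
  ∷-cong : ∀ {B : Set} (b : B) {f g : Vector B k} → f ≗ g → b Vector.∷ f ≗ b Vector.∷ g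
  ∷-cong b eq zero    = refl
  ∷-cong b eq (suc i) = eq i

module _ (G : Graph) where
  open Graph G

  Reach-trans : ∀ {S u v w} → Reach G S u v → Reach G S v w → Reach G S u w
  Reach-trans here r′ = r′
  Reach-trans (step e s j r) r′ = step e s j (Reach-trans r r′)

  Reach-snoc : ∀ {S u v w} → Reach G S u v → ∀ e → S e → Joins G e v w → Reach G S u w
  Reach-snoc r e s j = Reach-trans r (step e s j here)

  Joins? : ∀ e u v → Dec (Joins G e u v)
  Joins? e u v = Product.≡-dec _≟_ _≟_ (ends e) (u , v) ⊎-dec Product.≡-dec _≟_ _≟_ (ends e) (v , u)

  -- The vertices reachable from u are computed as the limit of the balls around u,
  -- which stabilise within n steps because they grow strictly until then.
  module _ {S : Edge G → Set} (S? : Decidable S) (u : Vertex G) where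
    Adjacent : Subset n → Vertex G → Set
    Adjacent R y = ∃[ e ] ∃[ x ] (S e × x ∈ R × Joins G e x y)

    Adjacent? : ∀ R → Decidable (Adjacent R)
    Adjacent? R y = any? λ e → any? λ x → S? e ×-dec x ∈? R ×-dec Joins? e x y

    Expansion? : ∀ R → Decidable (λ y → y ∈ R ⊎ Adjacent R y)
    Expansion? R y = y ∈? R ⊎-dec Adjacent? R y

    expand : Subset n → Subset n
    expand R = toSubset (Expansion? R)

    ⊆-expand : ∀ {R} → R ⊆ expand R
    ⊆-expand {R} = ∈-toSubset⁺ (Expansion? R) ∘ inj₁

    ball : ℕ → Subset n
    ball zero    = ⁅ u ⁆
    ball (suc k) = expand (ball k)

    ball-reachable : ∀ k {y} → y ∈ ball k → Reach G S u y
    ball-reachable zero    y∈ rewrite x∈⁅y⁆⇒x≡y u y∈ = here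
    ball-reachable (suc k) y∈ with ∈-toSubset⁻ (Expansion? (ball k)) y∈
    ... | inj₁ y∈′                  = ball-reachable k y∈′
    ... | inj₂ (e , x , s , x∈ , j) = Reach-snoc (ball-reachable k x∈) e s j

    centre∈ball : ∀ k → u ∈ ball k
    centre∈ball zero    = x∈⁅x⁆ u
    centre∈ball (suc k) = ⊆-expand (centre∈ball k)

    expand-closed⇒Reach-closed : ∀ {R} → expand R ⊆ R → ∀ {x y} → Reach G S x y → x ∈ R → y ∈ R
    expand-closed⇒Reach-closed closed here x∈ = x∈
    expand-closed⇒Reach-closed {R} closed (step e s j r) x∈ =
      expand-closed⇒Reach-closed closed r (closed (∈-toSubset⁺ (Expansion? R) (inj₂ (e , _ , s , x∈ , j))))

    ⊂-expand : ∀ {R} → ¬ (expand R ⊆ R) → R ⊂ expand R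
    ⊂-expand {R} ¬closed
      with ¬∀⟶∃¬ n _ (λ x → x ∈? expand R →-dec x ∈? R) (λ closed → ¬closed (closed _))
    ... | x , ¬x∈⇒x∈ with x ∈? expand R
    ...   | yes x∈ = ⊆-expand , x , x∈ , λ x∈R → ¬x∈⇒x∈ λ _ → x∈R
    ...   | no x∉  = ⊥-elim (¬x∈⇒x∈ (⊥-elim ∘ x∉))

    Stabilises : Set
    Stabilises = ∃[ k ] (expand (ball k) ⊆ ball k)

    ball-grows : ∀ k → Stabilises ⊎ suc k ≤ ∣ ball k ∣
    ball-grows zero = inj₂ (ℕₚ.≤-reflexive (sym (∣⁅x⁆∣≡1 u)))
    ball-grows (suc k) with ball-grows k
    ... | inj₁ stable = inj₁ stable
    ... | inj₂ size with expand (ball k) ⊆? ball k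
    ...   | yes closed = inj₁ (k , closed)
    ...   | no ¬closed = inj₂ (ℕₚ.≤-trans (s≤s size) (p⊂q⇒∣p∣<∣q∣ (⊂-expand ¬closed)))

    ball-stabilises : Stabilises
    ball-stabilises with ball-grows n
    ... | inj₁ stable = stable
    ... | inj₂ size   = ⊥-elim (ℕₚ.<-irrefl refl (ℕₚ.≤-trans size (∣p∣≤n (ball n))))

    Reach? : Decidable (Reach G S u)
    Reach? v with ball-stabilises
    ... | k , closed =
      map′ (ball-reachable k) (λ r → expand-closed⇒Reach-closed closed r (centre∈ball k)) (v ∈? ball k)

  -- Proper 3-edge colourings of cubic graphs

  avoids? : (c : Edge G → Fin 3) (i : Fin 3) → Decidable (λ e → c e ≢ i)
  avoids? c i e = ¬? (c e ≟ i)

  colourClass : (Edge G → Fin 3) → Fin 3 → Subset m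
  colourClass c x = toSubset (λ e → c e ≟ x)

  colourClass⁺ : ∀ c {x e} → c e ≡ x → e ∈ colourClass c x
  colourClass⁺ c {x} = ∈-toSubset⁺ (λ e → c e ≟ x)

  colourClass⁻ : ∀ c {x e} → e ∈ colourClass c x → c e ≡ x
  colourClass⁻ c {x} = ∈-toSubset⁻ (λ e → c e ≟ x)

  colourClass-≡⇒ : ∀ c c′ {x x′ e} → colourClass c x ≡ colourClass c′ x′ → c e ≡ x → c′ e ≡ x′
  colourClass-≡⇒ c c′ same ce = colourClass⁻ c′ (subst (_ ∈_) same (colourClass⁺ c ce))

  incidentEdges : Vertex G → List (Edge G)
  incidentEdges v = filter (λ e → incident? G e v) (allFin m)

  module _ (cubic : Cubic G) {c : Edge G → Fin 3} (proper : Proper3EdgeColouring G c) where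

    rainbow-star : ∀ v → ∃[ a ] ∃[ b ] ∃[ d ]
      (incidentEdges v ≡ a ∷ b ∷ d ∷ [] × Incident G a v × Incident G b v × Incident G d v
       × c a ≢ c b × c a ≢ c d × c b ≢ c d)
    rainbow-star v =
      let a , b , d , eq , a∼v , b∼v , d∼v , a≢b , a≢d , b≢d =
            unique-triple (incidentEdges v) (cubic v) (all-filter (λ e → incident? G e v) (allFin m))
                          (Unique.filter⁺ (λ e → incident? G e v) (Unique.allFin⁺ m))
      in a , b , d , eq , a∼v , b∼v , d∼v ,
         proper a b v a≢b a∼v b∼v , proper a d v a≢d a∼v d∼v , proper b d v b≢d b∼v d∼v

    colourAt : ∀ v x → ∃[ e ] (Incident G e v × c e ≡ x)
    colourAt v x with rainbow-star v
    ... | a , b , d , _ , a∼v , b∼v , d∼v , ca≢cb , ca≢cd , cb≢cd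
        with distinct-cover _ _ _ ca≢cb ca≢cd cb≢cd x
    ... | inj₁ x≡ca        = a , a∼v , sym x≡ca
    ... | inj₂ (inj₁ x≡cb) = b , b∼v , sym x≡cb
    ... | inj₂ (inj₂ x≡cd) = d , d∼v , sym x≡cd

    colourClass-perfectMatching : ∀ x → PerfectMatching G (colourClass c x)
    colourClass-perfectMatching x v with colourAt v x
    ... | e , e∼v , ce≡x = e , colourClass⁺ c ce≡x , e∼v , unique
      where
      unique : ∀ f → f ∈ colourClass c x → Incident G f v → f ≡ e
      unique f f∈ f∼v with f ≟ e
      ... | yes f≡e = f≡e
      ... | no f≢e  = ⊥-elim (proper f e v f≢e f∼v e∼v (trans (colourClass⁻ c f∈) (sym ce≡x)))

    colourClass-injective : Vertex G → ∀ {x y} → colourClass c x ≡ colourClass c y → x ≡ y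
    colourClass-injective v {x} same with colourAt v x
    ... | e , _ , ce≡x = trans (sym ce≡x) (colourClass-≡⇒ c c same ce≡x)

    removal-2-regular : ∀ i v →
      length (filter (λ e → avoids? c i e ×-dec incident? G e v) (allFin m)) ≡ 2
    removal-2-regular i v with rainbow-star v
    ... | a , b , d , eq , _ , _ , _ , ca≢cb , ca≢cd , cb≢cd = begin
      length (filter (λ e → avoids? c i e ×-dec incident? G e v) (allFin m))
        ≡⟨ cong length (filter-×-dec (avoids? c i) (λ e → incident? G e v) (allFin m)) ⟩
      length (filter (avoids? c i) (incidentEdges v))
        ≡⟨ cong (length ∘ filter (avoids? c i)) eq ⟩
      length (filter (avoids? c i) (a ∷ b ∷ d ∷ []))
        ≡⟨ length-filter-map (λ k → ¬? (k ≟ i)) c (a ∷ b ∷ d ∷ []) ⟩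
      length (filter (λ k → ¬? (k ≟ i)) (c a ∷ c b ∷ c d ∷ []))
        ≡⟨ distinct-avoid-count _ _ _ ca≢cb ca≢cd cb≢cd i ⟩
      2 ∎
      where open ≡-Reasoning

    removal-disconnected : ∀ i → ¬ RemovalHamiltonian G c i →
      ∃[ u ] ∃[ w ] ¬ Reach G (λ e → c e ≢ i) u w
    removal-disconnected i ¬ham =
      let u , ¬u↠all = ¬∀⟶∃¬ n _ (λ u → all? (Reach? (avoids? c i) u))
                                 (λ connected → ¬ham (removal-2-regular i , connected))
          w , u↛w    = ¬∀⟶∃¬ n _ (Reach? (avoids? c i) u) ¬u↠all
      in u , w , u↛w

  -- A Kempe switch: an edge lies in the component of u in G minus the r-edges when it avoids r
  -- and its first end is reachable from u; exactly these edges get s and t swapped.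
  module KempeSwitch {c : Edge G → Fin 3} (proper : Proper3EdgeColouring G c)
                     {r s t : Fin 3} (r≢s : r ≢ s) (r≢t : r ≢ t) (u : Vertex G) where
    Avoids-r : Edge G → Set
    Avoids-r e = c e ≢ r

    InComponent : Edge G → Set
    InComponent e = Avoids-r e × Reach G Avoids-r u (proj₁ (ends e))

    InComponent? : Decidable InComponent
    InComponent? e = avoids? c r e ×-dec Reach? (avoids? c r) u (proj₁ (ends e))

    σ : Fin 3 → Fin 3
    σ = PC.transpose s t

    σ-avoids-r : ∀ {x} → x ≢ r → σ x ≢ r
    σ-avoids-r x≢r σx≡r = x≢r (transpose-injective s t (trans σx≡r (sym (transpose-fixes r≢s r≢t))))

    switched : Edge G → Fin 3
    switched e with InComponent? e
    ... | yes _ = σ (c e)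
    ... | no _  = c e

    component-reaches-ends : ∀ {e v} → InComponent e → Incident G e v → Reach G Avoids-r u v
    component-reaches-ends (_ , u↠e) (inj₁ refl) = u↠e
    component-reaches-ends {e} (e≢r , u↠e) (inj₂ refl) = Reach-snoc u↠e e e≢r (inj₁ refl)

    component-closed : ∀ {e f v} → InComponent e → Incident G e v → Incident G f v → Avoids-r f →
      InComponent f
    component-closed e∈ e∼v (inj₁ refl) f≢r = f≢r , component-reaches-ends e∈ e∼v
    component-closed {f = f} e∈ e∼v (inj₂ refl) f≢r =
      f≢r , Reach-snoc (component-reaches-ends e∈ e∼v) f f≢r (inj₂ refl)

    inside≢outside : ∀ {e f v} → InComponent e → ¬ InComponent f → Incident G e v → Incident G f v →
      σ (c e) ≢ c f
    inside≢outside {f = f} e∈ f∉ e∼v f∼v with c f ≟ r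
    ... | yes cf≡r = λ σce≡cf → σ-avoids-r (proj₁ e∈) (trans σce≡cf cf≡r)
    ... | no cf≢r  = ⊥-elim (f∉ (component-closed e∈ e∼v f∼v cf≢r))

    switched-proper : Proper3EdgeColouring G switched
    switched-proper e f v e≢f e∼v f∼v with InComponent? e | InComponent? f
    ... | yes _   | yes _   = proper e f v e≢f e∼v f∼v ∘ transpose-injective s t
    ... | no _    | no _    = proper e f v e≢f e∼v f∼v
    ... | yes e∈  | no f∉   = inside≢outside e∈ f∉ e∼v f∼v
    ... | no e∉   | yes f∈  = inside≢outside f∈ e∉ f∼v e∼v ∘ sym

    switched-fixes-r : ∀ {e} → c e ≡ r → switched e ≡ r
    switched-fixes-r {e} ce≡r with InComponent? e
    ... | yes (ce≢r , _) = ⊥-elim (ce≢r ce≡r)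
    ... | no _           = ce≡r

    switched-avoids-r : ∀ {e} → c e ≢ r → switched e ≢ r
    switched-avoids-r {e} ce≢r with InComponent? e
    ... | yes _ = σ-avoids-r ce≢r
    ... | no _  = ce≢r

    switched-at-centre : ∀ {e} → Incident G e u → c e ≡ s → switched e ≡ t
    switched-at-centre {e} e∼u ce≡s with InComponent? e
    ... | yes _  = trans (cong σ ce≡s) (transpose-matchˡ s t)
    ... | no e∉ = ⊥-elim (e∉ (ce≢r , centre-reaches e∼u))
      where
      ce≢r : Avoids-r e
      ce≢r ce≡r = r≢s (trans (sym ce≡r) ce≡s)
      centre-reaches : Incident G e u → Reach G Avoids-r u (proj₁ (ends e))
      centre-reaches (inj₁ refl) = here
      centre-reaches (inj₂ refl) = step e ce≢r (inj₂ refl) here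

    switched-away : ∀ {e w} → ¬ Reach G Avoids-r u w → Incident G e w → switched e ≡ c e
    switched-away {e} u↛w e∼w with InComponent? e
    ... | yes e∈ = ⊥-elim (u↛w (component-reaches-ends e∈ e∼w))
    ... | no _   = refl

  -- Fulkerson coverings from two colourings

  module _ (cubic : Cubic G) {c₁ c₂ : Edge G → Fin 3}
           (proper₁ : Proper3EdgeColouring G c₁) (proper₂ : Proper3EdgeColouring G c₂) where
    colouring : Fin 2 → Edge G → Fin 3
    colouring k e = choose (c₁ e) (c₂ e) k

    colouring-proper : ∀ k → Proper3EdgeColouring G (colouring k)
    colouring-proper zero       = proper₁
    colouring-proper (suc zero) = proper₂

    classes : Fin 6 → Subset m
    classes i = colourClass (colouring (quotient {2} 3 i)) (remainder {2} 3 i)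

    classes-count : ∀ e → length (filter (λ i → e ∈? classes i) (allFin 6)) ≡ 2
    classes-count e = trans
      (cong length (filter-≐ (λ i → e ∈? classes i)
                             (λ i → colouring (quotient {2} 3 i) e ≟ remainder {2} 3 i)
                             ((λ {i} → colourClass⁻ (colouring (quotient {2} 3 i))) ,
                              (λ {i} → colourClass⁺ (colouring (quotient {2} 3 i))))
                             (allFin 6)))
      (choose-count (c₁ e) (c₂ e))

    module _ (v : Vertex G) (separated : ∀ x y → colourClass c₁ x ≢ colourClass c₂ y) where
      colouring-classes-injective : ∀ k l {x y} →
        colourClass (colouring k) x ≡ colourClass (colouring l) y → (k , x) ≡ (l , y)
      colouring-classes-injective zero       zero       same =
        cong (zero ,_) (colourClass-injective cubic proper₁ v same)
      colouring-classes-injective zero       (suc zero) same = ⊥-elim (separated _ _ same)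
      colouring-classes-injective (suc zero) zero       same = ⊥-elim (separated _ _ (sym same))
      colouring-classes-injective (suc zero) (suc zero) same =
        cong (suc zero ,_) (colourClass-injective cubic proper₂ v same)

      separated⇒properFulkersonCovering : ProperFulkersonCovering G
      separated⇒properFulkersonCovering =
        classes ,
        ((λ i → colourClass-perfectMatching cubic (colouring-proper (quotient {2} 3 i)) (remainder {2} 3 i)) ,
         classes-count) ,
        λ i j i≢j same → i≢j (remQuot-injective 3 (colouring-classes-injective _ _ same))

  -- Decidability

  PerfectMatching? : Decidable (PerfectMatching G)
  PerfectMatching? M = all? λ v → any? λ e → e ∈? M ×-dec incident? G e v ×-dec
    all? λ f → f ∈? M →-dec incident? G f v →-dec f ≟ e

  ProperFulkerson : (Fin 6 → Subset m) → Set
  ProperFulkerson M = FulkersonCovering G M × (∀ i j → i ≢ j → M i ≢ M j)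

  ProperFulkerson? : Decidable ProperFulkerson
  ProperFulkerson? M =
    ((all? λ i → PerfectMatching? (M i))
       ×-dec (all? λ e → length (filter (λ i → e ∈? M i) (allFin 6)) ℕ.≟ 2))
    ×-dec (all? λ i → all? λ j → ¬? (i ≟ j) →-dec ¬? (Vec.≡-dec Bool._≟_ (M i) (M j)))

  ProperFulkerson-resp-≗ : ∀ {M M′} → M ≗ M′ → ProperFulkerson M → ProperFulkerson M′
  ProperFulkerson-resp-≗ {M} {M′} M≗M′ ((matchings , count) , distinct) =
    ((λ i → subst (PerfectMatching G) (M≗M′ i) (matchings i)) ,
     (λ e → trans (cong length (filter-≐ (λ i → e ∈? M′ i) (λ i → e ∈? M i)
                                  (subst (e ∈_) (sym (M≗M′ _)) , subst (e ∈_) (M≗M′ _)) (allFin 6)))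
                  (count e))) ,
    λ i j i≢j same → distinct i j i≢j (trans (M≗M′ i) (trans same (sym (M≗M′ j))))

  properFulkersonCovering? : Dec (ProperFulkersonCovering G)
  properFulkersonCovering? = any-Vector? 6 anySubset? ProperFulkerson? ProperFulkerson-resp-≗

  RemovalHamiltonian? : ∀ c → Decidable (RemovalHamiltonian G c)
  RemovalHamiltonian? c i =
    (all? λ v → length (filter (λ e → avoids? c i e ×-dec incident? G e v) (allFin m)) ℕ.≟ 2)
    ×-dec (all? λ u → all? (Reach? (avoids? c i) u))

  twoRemovalsHamiltonian? : ∀ c →
    Dec (∃[ i ] ∃[ j ] (i ≢ j × RemovalHamiltonian G c i × RemovalHamiltonian G c j))
  twoRemovalsHamiltonian? c =
    any? λ i → any? λ j → ¬? (i ≟ j) ×-dec RemovalHamiltonian? c i ×-dec RemovalHamiltonian? c j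

  module TwoKempeSwitches (cubic : Cubic G) {c : Edge G → Fin 3} (proper : Proper3EdgeColouring G c)
           {a b t : Fin 3} (a≢b : a ≢ b) (a≢t : a ≢ t) (b≢t : b ≢ t)
           {u₁ w₁ : Vertex G} (u₁↛w₁ : ¬ Reach G (λ e → c e ≢ a) u₁ w₁)
           {u₂ w₂ : Vertex G} (u₂↛w₂ : ¬ Reach G (λ e → c e ≢ b) u₂ w₂) where
    open ≡-Reasoning
    module K₁ = KempeSwitch proper a≢b a≢t u₁
    module K₂ = KempeSwitch proper (a≢b ∘ sym) b≢t u₂

    forward : ∀ {x y e} → colourClass K₁.switched x ≡ colourClass K₂.switched y →
      K₁.switched e ≡ x → K₂.switched e ≡ y
    forward = colourClass-≡⇒ K₁.switched K₂.switched

    backward : ∀ {x y e} → colourClass K₁.switched x ≡ colourClass K₂.switched y →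
      K₂.switched e ≡ y → K₁.switched e ≡ x
    backward same = colourClass-≡⇒ K₂.switched K₁.switched (sym same)

    -- Each case confronts an edge at a switch centre with an edge at a vertex the switch misses.
    separated-a : ∀ y → colourClass K₁.switched a ≢ colourClass K₂.switched y
    separated-a y same =
      let e  , e∼u₂  , ce≡a  = colourAt cubic proper u₂ a
          e′ , e′∼w₂ , ce′≡a = colourAt cubic proper w₂ a
      in a≢t (begin
        a                ≡⟨ ce′≡a ⟨
        c e′             ≡⟨ K₂.switched-away u₂↛w₂ e′∼w₂ ⟨
        K₂.switched e′   ≡⟨ forward same (K₁.switched-fixes-r ce′≡a) ⟩
        y                ≡⟨ forward same (K₁.switched-fixes-r ce≡a) ⟨
        K₂.switched e    ≡⟨ K₂.switched-at-centre e∼u₂ ce≡a ⟩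
        t                ∎)

    separated-b : ∀ y → colourClass K₁.switched b ≢ colourClass K₂.switched y
    separated-b y same =
      let e  , e∼w₁  , ce≡b  = colourAt cubic proper w₁ b
          e′ , e′∼u₁ , ce′≡b = colourAt cubic proper u₁ b
          b≡y : b ≡ y
          b≡y = trans (sym (K₂.switched-fixes-r ce≡b))
                      (forward same (trans (K₁.switched-away u₁↛w₁ e∼w₁) ce≡b))
      in b≢t (begin
        b                ≡⟨ backward same (trans (K₂.switched-fixes-r ce′≡b) b≡y) ⟨
        K₁.switched e′   ≡⟨ K₁.switched-at-centre e′∼u₁ ce′≡b ⟩
        t                ∎)

    separated-t : ∀ y → colourClass K₁.switched t ≢ colourClass K₂.switched y
    separated-t y same =
      let e  , e∼u₁  , ce≡b  = colourAt cubic proper u₁ b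
          e′ , e′∼w₁ , ce′≡t = colourAt cubic proper w₁ t
      in K₂.switched-avoids-r (λ ce′≡b → b≢t (trans (sym ce′≡b) ce′≡t)) (begin
        K₂.switched e′   ≡⟨ forward same (trans (K₁.switched-away u₁↛w₁ e′∼w₁) ce′≡t) ⟩
        y                ≡⟨ forward same (K₁.switched-at-centre e∼u₁ ce≡b) ⟨
        K₂.switched e    ≡⟨ K₂.switched-fixes-r ce≡b ⟩
        b                ∎)

    switches-separated : ∀ x y → colourClass K₁.switched x ≢ colourClass K₂.switched y
    switches-separated x y with distinct-cover a b t a≢b a≢t b≢t x
    ... | inj₁ refl        = separated-a y
    ... | inj₂ (inj₁ refl) = separated-b y
    ... | inj₂ (inj₂ refl) = separated-t y

  two-removals-nonHamiltonian⇒properFulkersonCovering : Cubic G → ∀ {c} → Proper3EdgeColouring G c →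
    ∀ {a b} → a ≢ b → ¬ RemovalHamiltonian G c a → ¬ RemovalHamiltonian G c b → ProperFulkersonCovering G
  two-removals-nonHamiltonian⇒properFulkersonCovering cubic proper {a} {b} a≢b ¬ham-a ¬ham-b =
    let t , a≢t , b≢t = third-colour a b
        u₁ , _ , u₁↛w₁ = removal-disconnected cubic proper a ¬ham-a
        _  , _ , u₂↛w₂ = removal-disconnected cubic proper b ¬ham-b
        open TwoKempeSwitches cubic proper a≢b a≢t b≢t u₁↛w₁ u₂↛w₂
    in separated⇒properFulkersonCovering cubic K₁.switched-proper K₂.switched-proper u₁ switches-separated

proposition6p2 : (G : Graph) → Cubic G → Bridgeless G → ThreeEdgeColourable G →
    ¬ BiHamiltonian G → ProperFulkersonCovering G
proposition6p2 G cubic _ _ ¬biHamiltonian =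
  decidable-stable (properFulkersonCovering? G) λ ¬covering →
  ¬biHamiltonian λ c proper →
  decidable-stable (twoRemovalsHamiltonian? G c) λ ¬two →
  let a , b , a≢b , ¬ham-a , ¬ham-b = two-failures (RemovalHamiltonian? G c) ¬two
  in ¬covering (two-removals-nonHamiltonian⇒properFulkersonCovering G cubic proper a≢b ¬ham-a ¬ham-b)
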